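{- There is no algorithm in the read/write streams model that uses only one stream, $\log^{O(1)} n$ bits of internal memory and $\log^{O(1)} n$ passes and that finds the minimum period of every input string $s$ of length $n$.
   Context: Read/write streams model: an algorithm has an internal memory of $m$ bits and access to a fixed number of streams (tapes); each stream is a sequence of cells accessed sequentially by a read/write head; a pass is one sequential sweep over a stream. The input string is initially on the stream. The minimum period of $s$ is the least $\ell\ge1$ with $s[i]=s[i+\ell]$ for all $1\le i\le n-\ell$. -}

module Defs where

-- A one-stream read/write streams machine (uniform algorithm):
--   * a finite control (Q states) -- constant size, independent of n;
--   * an internal memory: a bit array (initially all 0) accessed by a head;
--     the number of memory cells used on inputs of length n is the memory bound;
--   * exactly one external stream: a one-way infinite tape over the alphabet
--     Fin (suc (k + e)) (symbol zero = blank, symbols 1..k = input letters,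
--     e extra working symbols), initially holding the input followed by blanks.
--   The number of passes over the stream = 1 + number of reversals of the
--   direction of the stream head.
--   Output convention: when the machine halts, the answer is the number
--   written in binary (least significant bit first) in the internal memory.

open import Data.Nat using (ℕ; zero; suc; _+_; _*_; _^_; _≤_; _<_; _≟_)
open import Data.Nat.Logarithm using (⌊log₂_⌋)
open import Data.Bool using (Bool; true; false; if_then_else_)
open import Data.Fin using (Fin; _↑ˡ_)
import Data.Fin as F
open import Data.Vec using (Vec; []; _∷_)
open import Data.Maybe using (Maybe; just; nothing)
open import Data.Product using (Σ; _×_; _,_; ∃)
open import Relation.Nullary using (yes; no)
open import Relation.Binary.PropositionalEquality using (_≡_)

data Move : Set where
  L S R : Move

move : Move → ℕ → ℕ
move L zero    = zero
move L (suc i) = i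
move S i       = i
move R i       = suc i

update : {A : Set} → (ℕ → A) → ℕ → A → (ℕ → A)
update f i a j with j ≟ i
... | yes _ = a
... | no  _ = f j

record Machine (k : ℕ) : Set where
  field
    Q     : ℕ
    e     : ℕ
    start : Fin Q
    halt  : Fin Q → Bool
    -- (state, internal bit read, stream symbol read) ↦
    -- (new state, bit written, stream symbol written, memory-head move, stream-head move)
    δ     : Fin Q → Bool → Fin (suc (k + e)) →
            Fin Q × Bool × Fin (suc (k + e)) × Move × Move

record Config {k : ℕ} (M : Machine k) : Set where
  field
    state : Fin (Machine.Q M)
    mem   : ℕ → Bool
    mhead : ℕ
    tape  : ℕ → Fin (suc (k + Machine.e M))
    thead : ℕ
    dir   : Move                      -- last non-stationary direction (S = none yet)
    revs  : ℕ

sameDir : Move → Move → Bool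
sameDir L L = true
sameDir R R = true
sameDir _ _ = false

trackDir : Move → ℕ → Move → Move × ℕ
trackDir d r S = d , r
trackDir S r m = m , r
trackDir d r m = if sameDir d m then (m , r) else (m , suc r)

initTape : {k e n : ℕ} → Vec (Fin k) n → ℕ → Fin (suc (k + e))
initTape []      _       = F.zero
initTape {e = e} (a ∷ s) zero    = F.suc (a ↑ˡ e)
initTape (a ∷ s) (suc i) = initTape s i

initConfig : {k n : ℕ} (M : Machine k) → Vec (Fin k) n → Config M
initConfig M s = record
  { state = Machine.start M ; mem = λ _ → false ; mhead = 0
  ; tape = initTape s ; thead = 0 ; dir = S ; revs = 0 }

step : {k : ℕ} (M : Machine k) → Config M → Config M
step M c with Machine.halt M (Config.state c)
... | true  = c
... | false with Machine.δ M (Config.state c) (Config.mem c (Config.mhead c))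
                                 (Config.tape c (Config.thead c))
...   | (q' , b , a , mm , tm) with trackDir (Config.dir c) (Config.revs c) tm
...     | (d' , r') = record
  { state = q'
  ; mem   = update (Config.mem c) (Config.mhead c) b
  ; mhead = move mm (Config.mhead c)
  ; tape  = update (Config.tape c) (Config.thead c) a
  ; thead = move tm (Config.thead c)
  ; dir   = d'
  ; revs  = r' }

run : {k n : ℕ} (M : Machine k) → Vec (Fin k) n → ℕ → Config M
run M s zero    = initConfig M s
run M s (suc t) = step M (run M s t)

binVal : (ℕ → Bool) → ℕ → ℕ
binVal f zero    = zero
binVal f (suc m) = (if f zero then 1 else 0) + 2 * binVal (λ i → f (suc i)) m

_‼_ : {A : Set} {n : ℕ} → Vec A n → ℕ → Maybe A
[]      ‼ _       = nothing
(a ∷ s) ‼ zero    = just a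
(a ∷ s) ‼ suc i   = s ‼ i

IsPeriod : {A : Set} {n : ℕ} → Vec A n → ℕ → Set
IsPeriod {n = n} s ℓ = (i : ℕ) → i + ℓ < n → s ‼ i ≡ s ‼ (i + ℓ)

IsMinPeriod : {A : Set} {n : ℕ} → Vec A n → ℕ → Set
IsMinPeriod s ℓ =
  1 ≤ ℓ × IsPeriod s ℓ × ((ℓ' : ℕ) → 1 ≤ ℓ' → IsPeriod s ℓ' → ℓ ≤ ℓ')

FindsMinPeriodWithin : {k n : ℕ} → Machine k → ℕ → Vec (Fin k) n → Set
FindsMinPeriodWithin M b s =
  Σ ℕ λ T →
      Machine.halt M (Config.state (run M s T)) ≡ true
    × ((t : ℕ) → Config.mhead (run M s t) < b)
    × suc (Config.revs (run M s T)) ≤ b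
    × IsMinPeriod s (binVal (Config.mem (run M s T)) b)

polylog : ℕ → ℕ → ℕ
polylog c n = c * (suc ⌊log₂ n ⌋) ^ c

-- A fooling-set argument with crossing sequences. For y ∈ {0,1}^K let x_y = 1 0^(K+1) y: the square
-- x_y x_y has minimum period |x_y|, while x_y x_y′ with y ≠ y′ does not have period |x_y|. Cut the input
-- in the middle and record, each time the stream head crosses the cut, the control state, the memory
-- contents and the memory head position. Every crossing after the first costs a reversal, so with b bits
-- and b passes there are at most (1 + Q 2^b b)^b crossing sequences, fewer than 2^K once b is
-- polylogarithmic in n = 4(K+1). Hence two distinct y, y′ share a crossing sequence, and the run on
-- x_y x_y′ is spliced from the runs on x_y x_y (left of the cut) and x_y′ x_y′ (right of it): it ends
-- with the final memory of one of them and answers |x_y|, which is wrong.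

module Submission where

open import Defs
open import Data.Nat using (ℕ; zero; suc; _+_; _*_; _^_; _∸_; _≤_; _<_; _≤′_; ≤′-refl; ≤′-step; _≟_; _<ᵇ_; _≤?_; _<?_; z≤n; s≤s; NonZero)
open import Data.Nat.Properties
open import Data.Nat.Logarithm using (⌊log₂_⌋; ⌊log₂[2^n]⌋≡n)
open import Data.Nat.Tactic.RingSolver using (solve-∀)
open import Data.Bool using (Bool; true; false; not; T; if_then_else_)
open import Data.Bool.Properties using (not-involutive)
import Data.Bool.Properties as Bool
open import Data.Fin using (Fin; toℕ; fromℕ<; _↑ˡ_; combine; funToFin; finToFun)
import Data.Fin as Fin
open import Data.Fin.Properties using (toℕ-fromℕ<; finToFun-funToFin; funToFin-finToFin; 2↔Bool; ↑ˡ-injective; combine-injective; pigeonhole)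
import Data.Fin.Properties as Finₚ
open import Data.Vec using (Vec; []; _∷_; _++_; replicate; tabulate; lookup)
open import Data.Vec.Properties using (∷-injectiveʳ; ++-injectiveʳ; lookup∘tabulate)
open import Data.List using (List; []; _∷_; _∷ʳ_; length)
import Data.List as List
open import Data.List.Properties using (length-++; ++-assoc; ++-cancelʳ; ∷ʳ-injective)
open import Data.List.Relation.Unary.All using (All; []; _∷_)
open import Data.Maybe using (just; nothing)
open import Data.Maybe.Properties using (just-injective)
open import Data.Product using (Σ; _×_; _,_; proj₁; proj₂; ∃; ∃₂)
open import Data.Sum using (_⊎_; inj₁; inj₂; swap)
open import Data.Empty using (⊥-elim)
open import Data.Unit using (tt)
open import Function using (_∘_; Inverse)
open import Relation.Nullary using (¬_; Dec; yes; no)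
open import Relation.Binary.PropositionalEquality

module _ {A : Set} where

  update-other : (f : ℕ → A) (i : ℕ) (a : A) {j : ℕ} → j ≢ i → update f i a j ≡ f j
  update-other f i a {j} j≢i with j ≟ i
  ... | yes j≡i = ⊥-elim (j≢i j≡i)
  ... | no _ = refl

  update-self : (f : ℕ → A) (i : ℕ) → update f i (f i) ≗ f
  update-self f i j with j ≟ i
  ... | yes refl = refl
  ... | no _ = refl

  update-cong-at : (f g : ℕ → A) (i : ℕ) (a : A) (j : ℕ) → f j ≡ g j → update f i a j ≡ update g i a j
  update-cong-at f g i a j fj≡gj with j ≟ i
  ... | yes _ = refl
  ... | no _ = fj≡gj

move-≤-suc : ∀ d h → move d h ≤ suc h
move-≤-suc L zero = z≤n
move-≤-suc L (suc h) = ≤-trans (n≤1+n h) (n≤1+n (suc h))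
move-≤-suc S h = n≤1+n h
move-≤-suc R h = ≤-refl

≤-suc-move : ∀ d h → h ≤ suc (move d h)
≤-suc-move L zero = z≤n
≤-suc-move L (suc h) = ≤-refl
≤-suc-move S h = n≤1+n h
≤-suc-move R h = ≤-trans (n≤1+n h) (n≤1+n (suc h))

move-L-≤ : ∀ h → move L h ≤ h
move-L-≤ zero = z≤n
move-L-≤ (suc h) = n≤1+n h

module _ {A : Set} where

  ≢-++-∷ : (P Y : List A) (e : A) → P ≢ Y List.++ e ∷ P
  ≢-++-∷ P Y e eq = m≢1+n+m (length P) (trans (cong length eq) (trans (length-++ Y) (+-suc (length Y) (length P))))

  ++-∷-injective : (Z Y P : List A) {a e : A} → Z List.++ a ∷ P ≡ Y List.++ e ∷ P → a ≡ e
  ++-∷-injective Z Y P {a} {e} eq = proj₂ (∷ʳ-injective Z Y (++-cancelʳ P (Z ∷ʳ a) (Y ∷ʳ e)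
    (trans (++-assoc Z _ P) (trans eq (sym (++-assoc Y _ P))))))

≢-not : ∀ {x σ : Bool} → x ≢ σ → x ≡ not σ
≢-not {false} {false} ne = ⊥-elim (ne refl)
≢-not {false} {true} ne = refl
≢-not {true} {false} ne = refl
≢-not {true} {true} ne = ⊥-elim (ne refl)

not-≢ : ∀ {σ} → not σ ≢ σ
not-≢ {false} ()
not-≢ {true} ()

-- Finite encodings

funToFin-injective : ∀ {m n} (f g : Fin m → Fin n) → funToFin f ≡ funToFin g → f ≗ g
funToFin-injective f g eq i =
  trans (sym (finToFun-funToFin f i)) (trans (cong (λ c → finToFun c i) eq) (finToFun-funToFin g i))

funToFin-cong : ∀ {m n} {f g : Fin m → Fin n} → f ≗ g → funToFin f ≡ funToFin g
funToFin-cong {zero} f≗g = refl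
funToFin-cong {suc m} f≗g = cong₂ combine (f≗g Fin.zero) (funToFin-cong (f≗g ∘ Fin.suc))

finToFun-injective : ∀ {m n} (i j : Fin (m ^ n)) → finToFun {m} {n} i ≗ finToFun j → i ≡ j
finToFun-injective {m} {n} i j same =
  trans (sym (funToFin-finToFin {n} {m} i)) (trans (funToFin-cong {n} {m} same) (funToFin-finToFin {n} {m} j))

tripleCode : ∀ {a c b} (e : Fin a × Fin c × ℕ) → proj₂ (proj₂ e) < b → Fin (a * (c * b))
tripleCode (q , w , h) h<b = combine q (combine w (fromℕ< h<b))

tripleCode-injective : ∀ {a c b} (e e′ : Fin a × Fin c × ℕ) (p : proj₂ (proj₂ e) < b) (p′ : proj₂ (proj₂ e′) < b) →
                       tripleCode e p ≡ tripleCode e′ p′ → e ≡ e′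
tripleCode-injective (q , w , h) (q′ , w′ , h′) p p′ eq with combine-injective q _ q′ _ eq
... | refl , eq′ with combine-injective w _ w′ _ eq′
...   | refl , eq″ = cong (λ x → q , w , x) (trans (sym (toℕ-fromℕ< p)) (trans (cong toℕ eq″) (toℕ-fromℕ< p′)))

-- Lists of length at most d, padded with zero, as base-(N+1) numerals with d digits.
module _ {A : Set} {P : A → Set} {N : ℕ} (code : ∀ x → P x → Fin N)
         (code-injective : ∀ x y (px : P x) (py : P y) → code x px ≡ code y py → x ≡ y) where

  listCode : ∀ d (xs : List A) → All P xs → length xs ≤ d → Fin (suc N ^ d)
  listCode zero [] [] _ = Fin.zero
  listCode (suc d) [] [] _ = combine (Fin.zero {N}) (listCode d [] [] z≤n)
  listCode (suc d) (x ∷ xs) (px ∷ pxs) (s≤s ≤d) = combine (Fin.suc (code x px)) (listCode d xs pxs ≤d)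

  listCode-injective : ∀ d xs ys pxs pys (p : length xs ≤ d) (q : length ys ≤ d) →
                       listCode d xs pxs p ≡ listCode d ys pys q → xs ≡ ys
  listCode-injective zero [] [] [] [] _ _ _ = refl
  listCode-injective (suc d) [] [] [] [] _ _ _ = refl
  listCode-injective (suc d) [] (y ∷ ys) [] (py ∷ pys) _ (s≤s q) eq
    with combine-injective (Fin.zero {N}) (listCode d [] [] z≤n) (Fin.suc (code y py)) (listCode d ys pys q) eq
  ... | () , _
  listCode-injective (suc d) (x ∷ xs) [] (px ∷ pxs) [] (s≤s p) _ eq
    with combine-injective (Fin.suc (code x px)) (listCode d xs pxs p) (Fin.zero {N}) (listCode d [] [] z≤n) eq
  ... | () , _
  listCode-injective (suc d) (x ∷ xs) (y ∷ ys) (px ∷ pxs) (py ∷ pys) (s≤s p) (s≤s q) eq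
    with combine-injective (Fin.suc (code x px)) (listCode d xs pxs p) (Fin.suc (code y py)) (listCode d ys pys q) eq
  ... | heads , tails = cong₂ _∷_ (code-injective x y px py (Finₚ.suc-injective heads))
                                  (listCode-injective d xs ys pxs pys p q tails)

-- Periods of words

module _ {A : Set} where

  ‼-++ˡ : ∀ {n p} (u : Vec A n) (v : Vec A p) {i} → i < n → (u ++ v) ‼ i ≡ u ‼ i
  ‼-++ˡ (a ∷ u) v {zero} _ = refl
  ‼-++ˡ (a ∷ u) v {suc i} (s≤s i<n) = ‼-++ˡ u v i<n

  ‼-++ʳ : ∀ {n p} (u : Vec A n) (v : Vec A p) i → (u ++ v) ‼ (n + i) ≡ v ‼ i
  ‼-++ʳ [] v i = refl
  ‼-++ʳ (a ∷ u) v i = ‼-++ʳ u v i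

  ‼-≥ : ∀ {n} (u : Vec A n) {i} → n ≤ i → u ‼ i ≡ nothing
  ‼-≥ [] _ = refl
  ‼-≥ (a ∷ u) {suc i} (s≤s n≤i) = ‼-≥ u n≤i

  ‼-replicate : ∀ n (a : A) {i} → i < n → replicate n a ‼ i ≡ just a
  ‼-replicate (suc n) a {zero} _ = refl
  ‼-replicate (suc n) a {suc i} (s≤s i<n) = ‼-replicate n a i<n

  ‼-ext : ∀ {n} (u v : Vec A n) → (∀ i → u ‼ i ≡ v ‼ i) → u ≡ v
  ‼-ext [] [] _ = refl
  ‼-ext (a ∷ u) (b ∷ v) same = cong₂ _∷_ (just-injective (same 0)) (‼-ext u v (same ∘ suc))

  ++-period⇒≡ : ∀ {n} (u v : Vec A n) → IsPeriod (u ++ v) n → u ≡ v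
  ++-period⇒≡ {n} u v period = ‼-ext u v same
    where
      same : ∀ i → u ‼ i ≡ v ‼ i
      same i with i <? n
      ... | yes i<n = begin
        u ‼ i              ≡⟨ ‼-++ˡ u v i<n ⟨
        (u ++ v) ‼ i       ≡⟨ period i (+-monoˡ-< n i<n) ⟩
        (u ++ v) ‼ (i + n) ≡⟨ cong ((u ++ v) ‼_) (+-comm i n) ⟩
        (u ++ v) ‼ (n + i) ≡⟨ ‼-++ʳ u v i ⟩
        v ‼ i              ∎
        where open ≡-Reasoning
      ... | no i≮n = trans (‼-≥ u (≮⇒≥ i≮n)) (sym (‼-≥ v (≮⇒≥ i≮n)))

  square-period : ∀ {n} (u : Vec A n) → IsPeriod (u ++ u) n
  square-period {n} u i i+n<2n = begin
    (u ++ u) ‼ i       ≡⟨ ‼-++ˡ u u (+-cancelʳ-< n i n i+n<2n) ⟩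
    u ‼ i              ≡⟨ ‼-++ʳ u u i ⟨
    (u ++ u) ‼ (n + i) ≡⟨ cong ((u ++ u) ‼_) (+-comm n i) ⟩
    (u ++ u) ‼ (i + n) ∎
    where open ≡-Reasoning

  -- A shift ℓ < n either moves position 0 into the first q positions, or moves one of them onto position n.
  square-minPeriod : ∀ {n} (u : Vec A n) q → n ≤ suc (q + q) → 1 ≤ n →
                     (∀ i → 1 ≤ i → i ≤ q → u ‼ i ≢ u ‼ 0) → IsMinPeriod (u ++ u) n
  square-minPeriod {n} u q n≤ 1≤n distinct = 1≤n , square-period u , minimal
    where
      minimal : ∀ ℓ → 1 ≤ ℓ → IsPeriod (u ++ u) ℓ → n ≤ ℓ
      minimal ℓ 1≤ℓ period with n ≤? ℓ
      ... | yes n≤ℓ = n≤ℓ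
      ... | no n≰ℓ with ℓ ≤? q
      ...   | yes ℓ≤q = ⊥-elim (distinct ℓ 1≤ℓ ℓ≤q (begin
        u ‼ ℓ         ≡⟨ ‼-++ˡ u u ℓ<n ⟨
        (u ++ u) ‼ ℓ  ≡⟨ period 0 (<-≤-trans ℓ<n (m≤m+n n n)) ⟨
        (u ++ u) ‼ 0  ≡⟨ ‼-++ˡ u u 1≤n ⟩
        u ‼ 0         ∎))
        where
          open ≡-Reasoning
          ℓ<n : ℓ < n
          ℓ<n = ≰⇒> n≰ℓ
      ...   | no ℓ≰q = ⊥-elim (distinct i 1≤i i≤q (begin
        u ‼ i              ≡⟨ ‼-++ˡ u u i<n ⟨
        (u ++ u) ‼ i       ≡⟨ period i (subst (_< n + n) (sym i+ℓ≡n) (m<m+n n 1≤n)) ⟩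
        (u ++ u) ‼ (i + ℓ) ≡⟨ cong ((u ++ u) ‼_) (trans i+ℓ≡n (sym (+-identityʳ n))) ⟩
        (u ++ u) ‼ (n + 0) ≡⟨ ‼-++ʳ u u 0 ⟩
        u ‼ 0              ∎))
        where
          open ≡-Reasoning
          ℓ<n : ℓ < n
          ℓ<n = ≰⇒> n≰ℓ
          i : ℕ
          i = n ∸ ℓ
          i+ℓ≡n : i + ℓ ≡ n
          i+ℓ≡n = m∸n+n≡m (<⇒≤ ℓ<n)
          1≤i : 1 ≤ i
          1≤i = m<n⇒0<n∸m ℓ<n
          i<n : i < n
          i<n = subst (i <_) i+ℓ≡n (m<m+n i 1≤ℓ)
          i≤q : i ≤ q
          i≤q = +-cancelʳ-≤ ℓ i q (≤-trans (≤-reflexive i+ℓ≡n) (≤-trans n≤ (≤-trans (≤-reflexive (sym (+-suc q q))) (+-monoʳ-≤ q (≰⇒> ℓ≰q)))))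

minPeriod-unique : ∀ {A : Set} {n} (s : Vec A n) {ℓ ℓ′} → IsMinPeriod s ℓ → IsMinPeriod s ℓ′ → ℓ ≡ ℓ′
minPeriod-unique s (1≤ℓ , ℓ-period , ℓ-min) (1≤ℓ′ , ℓ′-period , ℓ′-min) =
  ≤-antisym (ℓ-min _ 1≤ℓ′ ℓ′-period) (ℓ′-min _ 1≤ℓ ℓ-period)

module _ {k e : ℕ} where

  initTape-++ˡ : ∀ {n p} (u : Vec (Fin k) n) (v : Vec (Fin k) p) {i} → i < n →
                 initTape {k} {e} (u ++ v) i ≡ initTape u i
  initTape-++ˡ (a ∷ u) v {zero} _ = refl
  initTape-++ˡ (a ∷ u) v {suc i} (s≤s i<n) = initTape-++ˡ u v i<n

  initTape-++ʳ : ∀ {n p} (u : Vec (Fin k) n) (v : Vec (Fin k) p) i →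
                 initTape {k} {e} (u ++ v) (n + i) ≡ initTape v i
  initTape-++ʳ [] v i = refl
  initTape-++ʳ (a ∷ u) v i = initTape-++ʳ u v i

module Blocks (k′ K : ℕ) where

  bit : Fin 2 → Fin (2 + k′)
  bit = _↑ˡ k′

  blockLength : ℕ
  blockLength = suc (suc K + K)

  block : (Fin K → Fin 2) → Vec (Fin (2 + k′)) blockLength
  block y = bit (Fin.suc Fin.zero) ∷ (replicate (suc K) (bit Fin.zero) ++ tabulate (bit ∘ y))

  block-injective : ∀ y y′ → block y ≡ block y′ → y ≗ y′
  block-injective y y′ eq i = ↑ˡ-injective k′ _ _ (begin
    bit (y i)                       ≡⟨ lookup∘tabulate (bit ∘ y) i ⟨
    lookup (tabulate (bit ∘ y)) i   ≡⟨ cong (λ w → lookup w i) bits ⟩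
    lookup (tabulate (bit ∘ y′)) i  ≡⟨ lookup∘tabulate (bit ∘ y′) i ⟩
    bit (y′ i)                      ∎)
    where
      open ≡-Reasoning
      bits : tabulate (bit ∘ y) ≡ tabulate (bit ∘ y′)
      bits = ++-injectiveʳ (replicate (suc K) (bit Fin.zero)) _ (∷-injectiveʳ eq)

  block-minPeriod : ∀ y → IsMinPeriod (block y ++ block y) blockLength
  block-minPeriod y = square-minPeriod (block y) (suc K) (s≤s (+-monoʳ-≤ (suc K) (n≤1+n K))) (s≤s z≤n) blank≢marker
    where
      blank≢marker : ∀ i → 1 ≤ i → i ≤ suc K → block y ‼ i ≢ block y ‼ 0
      blank≢marker (suc i) _ (s≤s i≤K) eq with trans (sym (‼-replicate (suc K) (bit Fin.zero) (s≤s i≤K)))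
                                                (trans (sym (‼-++ˡ (replicate (suc K) _) (tabulate (bit ∘ y)) (s≤s i≤K))) eq)
      ... | ()

-- Arithmetic

n<2^n : ∀ n → n < 2 ^ n
n<2^n zero = s≤s z≤n
n<2^n (suc n) = +-mono-≤ (m^n>0 2 n) (≤-trans (n<2^n n) (m≤m+n (2 ^ n) 0))

-- The ring solver proves identities only; an inequality is reduced to one by exhibiting the slack z.
≤-by-padding : ∀ {x y} z → x + z ≡ y → x ≤ y
≤-by-padding {x} z eq = ≤-trans (m≤m+n x z) (≤-reflexive eq)

polynomial<exponential : ∀ a d → ∃ λ j → a * (3 + j) ^ d < 2 ^ j
polynomial<exponential a d = j , (begin-strict
  a * (3 + j) ^ d          ≤⟨ *-monoʳ-≤ a (^-monoˡ-≤ d 3+j≤) ⟩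
  a * (2 ^ (2 + U)) ^ d    ≡⟨ cong (a *_) (^-*-assoc 2 (2 + U) d) ⟩
  a * 2 ^ ((2 + U) * d)    <⟨ *-monoˡ-< (2 ^ ((2 + U) * d)) {{m^n≢0 2 ((2 + U) * d)}} (n<2^n a) ⟩
  2 ^ a * 2 ^ ((2 + U) * d) ≡⟨ ^-distribˡ-+-* 2 a _ ⟨
  2 ^ (a + (2 + U) * d)    ≤⟨ ^-monoʳ-≤ 2 exponent≤ ⟩
  2 ^ j                    ∎)
  where
    open ≤-Reasoning
    u : ℕ
    u = a + (d + d)
    U : ℕ
    U = u + u
    j : ℕ
    j = 2 ^ U
    3+j≤ : 3 + j ≤ 2 ^ (2 + U)
    3+j≤ with 2 ^ U | m^n>0 2 U
    ... | suc x | _ = ≤-by-padding (3 * x) (identity x)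
      where
        identity : ∀ x → 3 + suc x + 3 * x ≡ 2 * (2 * suc x)
        identity = solve-∀
    exponent≤ : a + (2 + U) * d ≤ j
    exponent≤ = begin
      a + (2 + U) * d      ≤⟨ ≤-by-padding (u * a + a + (d + d) + 1) (identity a d) ⟩
      suc u * suc u        ≤⟨ *-mono-≤ (n<2^n u) (n<2^n u) ⟩
      2 ^ u * 2 ^ u        ≡⟨ ^-distribˡ-+-* 2 u u ⟨
      2 ^ U                ∎
      where
        identity : ∀ a d → let u = a + (d + d) in
                   a + (2 + (u + u)) * d + (u * a + a + (d + d) + 1) ≡ suc u * suc u
        identity = solve-∀

suc-*-≤ : ∀ m n .{{_ : NonZero n}} → suc (m * n) ≤ suc m * n
suc-*-≤ m (suc n) = s≤s (m≤n+m (m * suc n) n)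

codes≤ : ∀ Q B → suc (Q * (2 ^ B * B)) ^ B ≤ 2 ^ ((Q + (B + B)) * B)
codes≤ Q B = begin
  suc (Q * (2 ^ B * B)) ^ B        ≤⟨ ^-monoˡ-≤ B base≤ ⟩
  (2 ^ (Q + (B + B))) ^ B          ≡⟨ ^-*-assoc 2 (Q + (B + B)) B ⟩
  2 ^ ((Q + (B + B)) * B)          ∎
  where
    open ≤-Reasoning
    base≤ : suc (Q * (2 ^ B * B)) ≤ 2 ^ (Q + (B + B))
    base≤ = begin
      suc (Q * (2 ^ B * B))        ≤⟨ s≤s (*-monoʳ-≤ Q (*-monoʳ-≤ (2 ^ B) (<⇒≤ (n<2^n B)))) ⟩
      suc (Q * (2 ^ B * 2 ^ B))    ≤⟨ suc-*-≤ Q (2 ^ B * 2 ^ B) {{m*n≢0 (2 ^ B) (2 ^ B) {{m^n≢0 2 B}} {{m^n≢0 2 B}}}} ⟩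
      suc Q * (2 ^ B * 2 ^ B)      ≤⟨ *-monoˡ-≤ (2 ^ B * 2 ^ B) (n<2^n Q) ⟩
      2 ^ Q * (2 ^ B * 2 ^ B)      ≡⟨ cong (2 ^ Q *_) (^-distribˡ-+-* 2 B B) ⟨
      2 ^ Q * 2 ^ (B + B)          ≡⟨ ^-distribˡ-+-* 2 Q (B + B) ⟨
      2 ^ (Q + (B + B))            ∎

square-bound : ∀ Q c P .{{_ : NonZero P}} →
               2 + (Q + (c * P + c * P)) * (c * P) ≤ ((Q + (c + c)) * c + 2) * (P * P)
square-bound Q c (suc p) = ≤-by-padding (Q * c * suc p * p + 2 * p * p + 4 * p) (identity Q c p)
  where
    identity : ∀ Q c p → 2 + (Q + (c * suc p + c * suc p)) * (c * suc p) + (Q * c * suc p * p + 2 * p * p + 4 * p)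
                         ≡ ((Q + (c + c)) * c + 2) * (suc p * suc p)
    identity = solve-∀

polylog[2^n] : ∀ c n → polylog c (2 ^ n) ≡ c * suc n ^ c
polylog[2^n] c n = cong (λ l → c * suc l ^ c) (⌊log₂[2^n]⌋≡n n)

doubleBlockLength : ∀ j → let K = 2 ^ j ∸ 1 in suc (suc K + K) + suc (suc K + K) ≡ 2 ^ (2 + j)
doubleBlockLength j = trans (identity (2 ^ j ∸ 1)) (cong (λ x → 2 * (2 * x)) (m∸n+n≡m (m^n>0 2 j)))
  where
    identity : ∀ K → suc (suc K + K) + suc (suc K + K) ≡ 2 * (2 * (K + 1))
    identity = solve-∀

2+m≤n⇒m<n∸1 : ∀ {m n} → 2 + m ≤ n → m < n ∸ 1
2+m≤n⇒m<n∸1 {n = suc n} (s≤s 1+m≤n) = 1+m≤n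

-- The number of crossing sequences against the number of fooling inputs, for input length 2 ^ (2 + j).
codes<inputs : ∀ Q c → ∃ λ j → let B = c * (3 + j) ^ c in suc (Q * (2 ^ B * B)) ^ B < 2 ^ (2 ^ j ∸ 1)
codes<inputs Q c = j , (begin-strict
  suc (Q * (2 ^ B * B)) ^ B        ≤⟨ codes≤ Q B ⟩
  2 ^ ((Q + (B + B)) * B)          <⟨ ^-monoʳ-< 2 (s≤s (s≤s z≤n)) exponent< ⟩
  2 ^ (2 ^ j ∸ 1)                  ∎)
  where
    open ≤-Reasoning
    a : ℕ
    a = (Q + (c + c)) * c + 2
    j : ℕ
    j = proj₁ (polynomial<exponential a (c + c))
    P : ℕ
    P = (3 + j) ^ c
    B : ℕ
    B = c * P
    exponent< : (Q + (B + B)) * B < 2 ^ j ∸ 1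
    exponent< = 2+m≤n⇒m<n∸1 (<⇒≤ (begin-strict
      2 + (Q + (B + B)) * B      ≤⟨ square-bound Q c P {{m^n≢0 (3 + j) c}} ⟩
      a * (P * P)                ≡⟨ cong (a *_) (^-distribˡ-+-* (3 + j) c c) ⟨
      a * (3 + j) ^ (c + c)      <⟨ proj₂ (polynomial<exponential a (c + c)) ⟩
      2 ^ j                      ∎))

binVal-cong : ∀ {f g} → f ≗ g → ∀ n → binVal f n ≡ binVal g n
binVal-cong f≗g zero = refl
binVal-cong f≗g (suc n) = cong₂ (λ x y → (if x then 1 else 0) + 2 * y) (f≗g 0) (binVal-cong (f≗g ∘ suc) n)

-- Machines: steps, sides of a boundary, crossing sequences

module Steps {k : ℕ} (M : Machine k) where
  open Machine M

  Symbol : Set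
  Symbol = Fin (suc (k + e))

  Action : Set
  Action = Fin Q × Bool × Symbol × Move × Move

  -- A halted machine performs the identity action: it rewrites what it reads and does not move.
  respond : Fin Q → Bool → Symbol → Action
  respond q b a = if halt q then (q , b , a , S , S) else δ q b a

  scanned : Config M → Symbol
  scanned c = Config.tape c (Config.thead c)

  action : Config M → Action
  action c = respond (Config.state c) (Config.mem c (Config.mhead c)) (scanned c)

  newState : Action → Fin Q
  newState (q , _ , _ , _ , _) = q

  writtenBit : Action → Bool
  writtenBit (_ , b , _ , _ , _) = b

  writtenSymbol : Action → Symbol
  writtenSymbol (_ , _ , a , _ , _) = a

  memoryMove : Action → Move
  memoryMove (_ , _ , _ , d , _) = d

  streamMove : Action → Move
  streamMove (_ , _ , _ , _ , d) = d

  step-state : ∀ c → Config.state (step M c) ≡ newState (action c)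
  step-state c with halt (Config.state c)
  ... | true = refl
  ... | false with δ (Config.state c) (Config.mem c (Config.mhead c)) (Config.tape c (Config.thead c))
  ...   | _ , _ , _ , _ , d with trackDir (Config.dir c) (Config.revs c) d
  ...     | _ = refl

  step-mem : ∀ c → Config.mem (step M c) ≗ update (Config.mem c) (Config.mhead c) (writtenBit (action c))
  step-mem c j with halt (Config.state c)
  ... | true = sym (update-self (Config.mem c) (Config.mhead c) j)
  ... | false with δ (Config.state c) (Config.mem c (Config.mhead c)) (Config.tape c (Config.thead c))
  ...   | _ , _ , _ , _ , d with trackDir (Config.dir c) (Config.revs c) d
  ...     | _ = refl

  step-tape : ∀ c → Config.tape (step M c) ≗ update (Config.tape c) (Config.thead c) (writtenSymbol (action c))
  step-tape c j with halt (Config.state c)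
  ... | true = sym (update-self (Config.tape c) (Config.thead c) j)
  ... | false with δ (Config.state c) (Config.mem c (Config.mhead c)) (Config.tape c (Config.thead c))
  ...   | _ , _ , _ , _ , d with trackDir (Config.dir c) (Config.revs c) d
  ...     | _ = refl

  step-mhead : ∀ c → Config.mhead (step M c) ≡ move (memoryMove (action c)) (Config.mhead c)
  step-mhead c with halt (Config.state c)
  ... | true = refl
  ... | false with δ (Config.state c) (Config.mem c (Config.mhead c)) (Config.tape c (Config.thead c))
  ...   | _ , _ , _ , _ , d with trackDir (Config.dir c) (Config.revs c) d
  ...     | _ = refl

  step-thead : ∀ c → Config.thead (step M c) ≡ move (streamMove (action c)) (Config.thead c)
  step-thead c with halt (Config.state c)
  ... | true = refl
  ... | false with δ (Config.state c) (Config.mem c (Config.mhead c)) (Config.tape c (Config.thead c))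
  ...   | _ , _ , _ , _ , d with trackDir (Config.dir c) (Config.revs c) d
  ...     | _ = refl

  step-dir-revs : ∀ c → (Config.dir (step M c) , Config.revs (step M c))
                        ≡ trackDir (Config.dir c) (Config.revs c) (streamMove (action c))
  step-dir-revs c with halt (Config.state c)
  ... | true = refl
  ... | false with δ (Config.state c) (Config.mem c (Config.mhead c)) (Config.tape c (Config.thead c))
  ...   | _ , _ , _ , _ , d with trackDir (Config.dir c) (Config.revs c) d
  ...     | _ = refl

  step-halted : ∀ c → halt (Config.state c) ≡ true → step M c ≡ c
  step-halted c h with halt (Config.state c)
  step-halted c refl | true = refl

  record Agree (c c′ : Config M) : Set where
    field
      same-state : Config.state c ≡ Config.state c′
      same-mem   : Config.mem c ≗ Config.mem c′
      same-mhead : Config.mhead c ≡ Config.mhead c′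
      same-thead : Config.thead c ≡ Config.thead c′
  open Agree public

  Agree-sym : ∀ {c c′} → Agree c c′ → Agree c′ c
  Agree-sym a = record
    { same-state = sym (same-state a) ; same-mem = sym ∘ same-mem a
    ; same-mhead = sym (same-mhead a) ; same-thead = sym (same-thead a) }

  Agree-trans : ∀ {c c′ c″} → Agree c c′ → Agree c′ c″ → Agree c c″
  Agree-trans a b = record
    { same-state = trans (same-state a) (same-state b) ; same-mem = λ i → trans (same-mem a i) (same-mem b i)
    ; same-mhead = trans (same-mhead a) (same-mhead b) ; same-thead = trans (same-thead a) (same-thead b) }

  Agree-action : ∀ {c c′} → Agree c c′ → scanned c ≡ scanned c′ → action c ≡ action c′
  Agree-action {c} {c′} a eq =
    cong₂ (λ q (bs : Bool × Symbol) → respond q (proj₁ bs) (proj₂ bs)) (same-state a)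
          (cong₂ _,_ (trans (same-mem a (Config.mhead c)) (cong (Config.mem c′) (same-mhead a))) eq)

  Agree-step : ∀ {c c′} → Agree c c′ → scanned c ≡ scanned c′ → Agree (step M c) (step M c′)
  Agree-step {c} {c′} a eq = record
    { same-state = begin
        Config.state (step M c)   ≡⟨ step-state c ⟩
        newState (action c)       ≡⟨ cong newState act ⟩
        newState (action c′)      ≡⟨ step-state c′ ⟨
        Config.state (step M c′)  ∎
    ; same-mem = λ i → begin
        Config.mem (step M c) i
          ≡⟨ step-mem c i ⟩
        update (Config.mem c) (Config.mhead c) (writtenBit (action c)) i
          ≡⟨ update-cong-at _ _ _ _ i (same-mem a i) ⟩
        update (Config.mem c′) (Config.mhead c) (writtenBit (action c)) i
          ≡⟨ cong₂ (λ h w → update (Config.mem c′) h w i) (same-mhead a) (cong writtenBit act) ⟩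
        update (Config.mem c′) (Config.mhead c′) (writtenBit (action c′)) i
          ≡⟨ step-mem c′ i ⟨
        Config.mem (step M c′) i ∎
    ; same-mhead = trans (step-mhead c) (trans (cong₂ move (cong memoryMove act) (same-mhead a)) (sym (step-mhead c′)))
    ; same-thead = trans (step-thead c) (trans (cong₂ move (cong streamMove act) (same-thead a)) (sym (step-thead c′)))
    }
    where
      open ≡-Reasoning
      act : action c ≡ action c′
      act = Agree-action a eq

module Boundary {k : ℕ} (M : Machine k) (m b : ℕ) where
  open Machine M
  open Steps M

  -- true: left of the boundary.
  side : ℕ → Bool
  side j = j <ᵇ m

  headSide : Config M → Bool
  headSide c = side (Config.thead c)

  side≡true⇒< : ∀ {j} → side j ≡ true → j < m
  side≡true⇒< {j} eq = <ᵇ⇒< j m (subst T (sym eq) tt)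

  side≡false⇒≥ : ∀ {j} → side j ≡ false → m ≤ j
  side≡false⇒≥ {j} eq = ≮⇒≥ (λ j<m → subst T eq (<⇒<ᵇ j<m))

  <⇒side≡true : ∀ {j} → j < m → side j ≡ true
  <⇒side≡true {j} j<m with side j in eq
  ... | true = refl
  ... | false = ⊥-elim (<⇒≱ j<m (side≡false⇒≥ eq))

  ≥⇒side≡false : ∀ {j} → m ≤ j → side j ≡ false
  ≥⇒side≡false {j} m≤j with side j in eq
  ... | false = refl
  ... | true = ⊥-elim (<⇒≱ (side≡true⇒< eq) m≤j)

  opposite-sides⇒≢ : ∀ σ {i j} → side i ≡ σ → side j ≡ not σ → j ≢ i
  opposite-sides⇒≢ false si sj refl with trans (sym si) sj
  ... | ()
  opposite-sides⇒≢ true si sj refl with trans (sym si) sj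
  ... | ()

  step-tape-opposite : ∀ σ c {j} → headSide c ≡ σ → side j ≡ not σ → Config.tape (step M c) j ≡ Config.tape c j
  step-tape-opposite σ c {j} hc sj =
    trans (step-tape c j) (update-other _ _ _ (opposite-sides⇒≢ σ hc sj))

  -- The cell entered when leaving side σ: m from the left (σ = true), m - 1 from the right.
  entryCell : Bool → ℕ
  entryCell true = m
  entryCell false = m ∸ 1

  crossing-thead : ∀ σ c → headSide c ≡ σ → headSide (step M c) ≡ not σ → Config.thead (step M c) ≡ entryCell σ
  crossing-thead true c before after = ≤-antisym
    (≤-trans (subst (_≤ suc (Config.thead c)) (sym (step-thead c)) (move-≤-suc (streamMove (action c)) _)) (side≡true⇒< before))
    (side≡false⇒≥ after)
  crossing-thead false c before after = cong (_∸ 1) (≤-antisym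
    (side≡true⇒< after)
    (≤-trans (side≡false⇒≥ before) (subst (λ h → Config.thead c ≤ suc h) (sym (step-thead c)) (≤-suc-move (streamMove (action c)) _))))

  MemoryWithin : Config M → Set
  MemoryWithin c = ∀ i → b ≤ i → Config.mem c i ≡ false

  -- Control state, the first b memory bits read as a number, and memory head position.
  Entry : Set
  Entry = Fin Q × Fin (2 ^ b) × ℕ

  entry : Config M → Entry
  entry c = Config.state c , funToFin (λ (i : Fin b) → Inverse.from 2↔Bool (Config.mem c (toℕ i))) , Config.mhead c

  entry-Agree : ∀ c c′ → entry c ≡ entry c′ → MemoryWithin c → MemoryWithin c′ →
                Config.thead c ≡ Config.thead c′ → Agree c c′
  entry-Agree c c′ eq wc wc′ th = record
    { same-state = cong proj₁ eq ; same-mem = same-mem′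
    ; same-mhead = cong (proj₂ ∘ proj₂) eq ; same-thead = th }
    where
      open Inverse 2↔Bool using (to; from; strictlyInverseˡ)
      same-bit : ∀ (i : Fin b) → Config.mem c (toℕ i) ≡ Config.mem c′ (toℕ i)
      same-bit i = trans (sym (strictlyInverseˡ _)) (trans
        (cong to (funToFin-injective _ _ (cong (proj₁ ∘ proj₂) eq) i)) (strictlyInverseˡ _))
      same-mem′ : Config.mem c ≗ Config.mem c′
      same-mem′ i with i <? b
      ... | yes i<b = subst (λ j → Config.mem c j ≡ Config.mem c′ j) (toℕ-fromℕ< i<b) (same-bit (fromℕ< i<b))
      ... | no i≮b = trans (wc i (≮⇒≥ i≮b)) (sym (wc′ i (≮⇒≥ i≮b)))

  -- While on side σ, h imitates x; its tape is x's tape on side σ and y's on the other side.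
  record Hybrid (σ : Bool) (h x y : Config M) : Set where
    field
      h-side : headSide h ≡ σ
      x-side : headSide x ≡ σ
      y-side : headSide y ≡ σ
      agree  : Agree h x
      tape-x : ∀ j → side j ≡ σ → Config.tape h j ≡ Config.tape x j
      tape-y : ∀ j → side j ≡ not σ → Config.tape h j ≡ Config.tape y j

  module _ {σ : Bool} {h x y : Config M} (H : Hybrid σ h x y) where
    open Hybrid H

    Hybrid-scanned : scanned h ≡ scanned x
    Hybrid-scanned = trans (tape-x (Config.thead h) h-side) (cong (Config.tape x) (same-thead agree))

    Hybrid-Agree-step : Agree (step M h) (step M x)
    Hybrid-Agree-step = Agree-step agree Hybrid-scanned

    Hybrid-headSide-step : headSide (step M x) ≡ headSide (step M h)
    Hybrid-headSide-step = cong side (sym (same-thead Hybrid-Agree-step))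

    Hybrid-tape-x-step : ∀ j → side j ≡ σ → Config.tape (step M h) j ≡ Config.tape (step M x) j
    Hybrid-tape-x-step j sj = begin
      Config.tape (step M h) j
        ≡⟨ step-tape h j ⟩
      update (Config.tape h) (Config.thead h) (writtenSymbol (action h)) j
        ≡⟨ update-cong-at _ _ _ _ j (tape-x j sj) ⟩
      update (Config.tape x) (Config.thead h) (writtenSymbol (action h)) j
        ≡⟨ cong₂ (λ i a → update (Config.tape x) i a j) (same-thead agree)
                 (cong writtenSymbol (Agree-action agree Hybrid-scanned)) ⟩
      update (Config.tape x) (Config.thead x) (writtenSymbol (action x)) j
        ≡⟨ step-tape x j ⟨
      Config.tape (step M x) j ∎
      where open ≡-Reasoning

    Hybrid-stay : headSide (step M h) ≡ σ → Hybrid σ (step M h) (step M x) y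
    Hybrid-stay stays = record
      { h-side = stays ; x-side = trans Hybrid-headSide-step stays ; y-side = y-side
      ; agree = Hybrid-Agree-step ; tape-x = Hybrid-tape-x-step
      ; tape-y = λ j sj → trans (step-tape-opposite σ h h-side sj) (tape-y j sj) }

    Hybrid-switch : headSide (step M h) ≡ not σ → (y′ : Config M) → headSide y′ ≡ not σ →
                    entry y′ ≡ entry (step M x) → MemoryWithin y′ → MemoryWithin (step M x) →
                    Config.thead y′ ≡ Config.thead (step M x) →
                    (∀ j → side j ≡ not σ → Config.tape y′ j ≡ Config.tape y j) →
                    Hybrid (not σ) (step M h) y′ (step M x)
    Hybrid-switch crosses y′ y′-side same-entry wy′ wx same-head y′-tape = record
      { h-side = crosses ; x-side = y′-side ; y-side = trans Hybrid-headSide-step crosses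
      ; agree = Agree-trans Hybrid-Agree-step (Agree-sym (entry-Agree y′ (step M x) same-entry wy′ wx same-head))
      ; tape-x = λ j sj → trans (step-tape-opposite σ h h-side sj) (trans (tape-y j sj) (sym (y′-tape j sj)))
      ; tape-y = λ j sj → Hybrid-tape-x-step j (trans sj (not-involutive σ)) }

module Runs {k : ℕ} (M : Machine k) (m b : ℕ) {n : ℕ} (s : Vec (Fin k) n) where
  open Steps M
  open Boundary M m b

  Halted : ℕ → Set
  Halted t = Machine.halt M (Config.state (run M s t)) ≡ true

  run-halted : ∀ {t u} → Halted t → t ≤ u → run M s u ≡ run M s t
  run-halted {t} halted t≤u = go (≤⇒≤′ t≤u)
    where
      go : ∀ {u} → t ≤′ u → run M s u ≡ run M s t
      go ≤′-refl = refl
      go (≤′-step t≤′u) = trans (cong (step M) (go t≤′u)) (step-halted (run M s t) halted)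

  Halted-unique : ∀ {t u} → Halted t → Halted u → run M s t ≡ run M s u
  Halted-unique {t} {u} ht hu with ≤-total t u
  ... | inj₁ t≤u = sym (run-halted ht t≤u)
  ... | inj₂ u≤t = run-halted hu u≤t

  Halted⇒stays : ∀ {T t} → Halted T → T ≤ t → headSide (run M s (suc t)) ≡ headSide (run M s t)
  Halted⇒stays {T} {t} halted T≤t =
    cong headSide (trans (run-halted halted (≤-trans T≤t (n≤1+n t))) (sym (run-halted halted T≤t)))

  run-MemoryWithin : (∀ t → Config.mhead (run M s t) < b) → ∀ t → MemoryWithin (run M s t)
  run-MemoryWithin bounded zero i b≤i = refl
  run-MemoryWithin bounded (suc t) i b≤i =
    trans (step-mem (run M s t) i) (trans (update-other _ _ _ i≢h) (run-MemoryWithin bounded t i b≤i))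
    where
      i≢h : i ≢ Config.mhead (run M s t)
      i≢h i≡h = <⇒≱ (bounded t) (subst (b ≤_) i≡h b≤i)

  -- The crossing sequence, most recent crossing first.
  crossings : ℕ → List Entry
  crossings zero = []
  crossings (suc t) with headSide (run M s (suc t)) Bool.≟ headSide (run M s t)
  ... | yes _ = crossings t
  ... | no _ = entry (run M s (suc t)) ∷ crossings t

  crossings-stay : ∀ t → headSide (run M s (suc t)) ≡ headSide (run M s t) → crossings (suc t) ≡ crossings t
  crossings-stay t stays with headSide (run M s (suc t)) Bool.≟ headSide (run M s t)
  ... | yes _ = refl
  ... | no moves = ⊥-elim (moves stays)

  crossings-cross : ∀ t → headSide (run M s (suc t)) ≢ headSide (run M s t) →
                    crossings (suc t) ≡ entry (run M s (suc t)) ∷ crossings t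
  crossings-cross t moves with headSide (run M s (suc t)) Bool.≟ headSide (run M s t)
  ... | yes stays = ⊥-elim (moves stays)
  ... | no _ = refl

  crossings-extend : ∀ t d → ∃ λ Y → crossings (t + d) ≡ Y List.++ crossings t
  crossings-extend t zero = [] , cong crossings (+-identityʳ t)
  crossings-extend t (suc d) with crossings-extend t d
  ... | Y , eq rewrite +-suc t d with headSide (run M s (suc (t + d))) Bool.≟ headSide (run M s (t + d))
  ...   | yes _ = Y , eq
  ...   | no _ = entry (run M s (suc (t + d))) ∷ Y , cong (entry (run M s (suc (t + d))) ∷_) eq

  crossings-halted : ∀ {t u} → Halted t → t ≤ u → crossings u ≡ crossings t
  crossings-halted {t} halted t≤u = go (≤⇒≤′ t≤u)
    where
      go : ∀ {u} → t ≤′ u → crossings u ≡ crossings t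
      go ≤′-refl = refl
      go (≤′-step {u} t≤′u) = trans (crossings-stay u (Halted⇒stays halted (≤′⇒≤ t≤′u))) (go t≤′u)

  record CrossingAfter (σ : Bool) (t : ℕ) (e : Entry) (P : List Entry) : Set where
    field
      at         : ℕ
      leaves     : headSide (run M s at) ≡ σ
      arrives    : headSide (run M s (suc at)) ≡ not σ
      entry≡     : entry (run M s (suc at)) ≡ e
      crossings≡ : crossings (suc at) ≡ e ∷ P
      tape-kept  : ∀ j → side j ≡ not σ → Config.tape (run M s (suc at)) j ≡ Config.tape (run M s t) j

  next-crossing : ∀ σ d t {P Y e} → headSide (run M s t) ≡ σ → crossings t ≡ P →
                  crossings (t + d) ≡ Y List.++ e ∷ P → CrossingAfter σ t e P
  next-crossing σ zero t {P} {Y} {e} on-σ now later =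
    ⊥-elim (≢-++-∷ P Y e (trans (sym now) (trans (cong crossings (sym (+-identityʳ t))) later)))
  next-crossing σ (suc d) t {P} {Y} {e} on-σ now later
    with headSide (run M s (suc t)) Bool.≟ headSide (run M s t)
  ... | yes stays = record
    { at = at ; leaves = leaves ; arrives = arrives ; entry≡ = entry≡ ; crossings≡ = crossings≡
    ; tape-kept = λ j sj → trans (tape-kept j sj) (step-tape-opposite σ (run M s t) on-σ sj) }
    where
      open CrossingAfter (next-crossing σ d (suc t) (trans stays on-σ) (trans (crossings-stay t stays) now)
                                       (trans (cong crossings (sym (+-suc t d))) later))
  ... | no moves = record
    { at = t ; leaves = on-σ ; arrives = ≢-not (λ q → moves (trans q (sym on-σ)))
    ; entry≡ = entry≡ ; crossings≡ = trans (crossings-cross t moves) (cong₂ _∷_ entry≡ now)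
    ; tape-kept = λ j sj → step-tape-opposite σ (run M s t) on-σ sj }
    where
      Z : List Entry
      Z = proj₁ (crossings-extend (suc t) d)
      entry≡ : entry (run M s (suc t)) ≡ e
      entry≡ = ++-∷-injective Z Y P (begin
        Z List.++ entry (run M s (suc t)) ∷ P           ≡⟨ cong (λ l → Z List.++ _ ∷ l) now ⟨
        Z List.++ entry (run M s (suc t)) ∷ crossings t ≡⟨ cong (Z List.++_) (crossings-cross t moves) ⟨
        Z List.++ crossings (suc t)                     ≡⟨ proj₂ (crossings-extend (suc t) d) ⟨
        crossings (suc t + d)                           ≡⟨ cong crossings (+-suc t d) ⟨
        crossings (t + suc d)                           ≡⟨ later ⟩
        Y List.++ e ∷ P                                 ∎)
        where open ≡-Reasoning

  moves⇒<halt : ∀ {T t} → Halted T → headSide (run M s (suc t)) ≢ headSide (run M s t) → t < T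
  moves⇒<halt {T} {t} halted moves with T ≤? t
  ... | yes T≤t = ⊥-elim (moves (Halted⇒stays halted T≤t))
  ... | no T≰t = ≰⇒> T≰t

  grows⇒≤halt : ∀ {T t Y e} → Halted T → crossings T ≡ Y List.++ e ∷ crossings t → t ≤ T
  grows⇒≤halt {T} {t} {Y} {e} halted grows with T ≤? t
  ... | yes T≤t = ⊥-elim (≢-++-∷ (crossings t) Y e (trans (crossings-halted halted T≤t) grows))
  ... | no T≰t = <⇒≤ (≰⇒> T≰t)

  crossings-heads : (∀ t → Config.mhead (run M s t) < b) → ∀ t → All (λ e → proj₂ (proj₂ e) < b) (crossings t)
  crossings-heads bounded zero = []
  crossings-heads bounded (suc t) with headSide (run M s (suc t)) Bool.≟ headSide (run M s t)
  ... | yes _ = crossings-heads bounded t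
  ... | no _ = bounded (suc t) ∷ crossings-heads bounded t

-- The direction in which the stream head enters side σ.
toward : Bool → Move
toward true = L
toward false = R

credit : Bool → Move → ℕ
credit σ S = 0
credit true L = 1
credit false L = 0
credit true R = 0
credit false R = 1

-- Reversals, plus one while the head still moves in the direction of its last crossing into side σ.
budget : Bool → Move × ℕ → ℕ
budget σ (d , r) = credit σ d + r

credit≤1 : ∀ σ d → credit σ d ≤ 1
credit≤1 σ S = z≤n
credit≤1 true L = s≤s z≤n
credit≤1 false L = z≤n
credit≤1 true R = z≤n
credit≤1 false R = s≤s z≤n

budget≤1+revs : ∀ σ d r → budget σ (d , r) ≤ suc r
budget≤1+revs σ d r = +-monoˡ-≤ r (credit≤1 σ d)

trackDir-budget : ∀ σ d r m → budget σ (d , r) ≤ budget σ (trackDir d r m)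
trackDir-budget σ d r S = ≤-refl
trackDir-budget σ S r L = m≤n+m r (credit σ L)
trackDir-budget σ S r R = m≤n+m r (credit σ R)
trackDir-budget σ L r L = ≤-refl
trackDir-budget σ R r R = ≤-refl
trackDir-budget σ L r R = ≤-trans (budget≤1+revs σ L r) (m≤n+m (suc r) (credit σ R))
trackDir-budget σ R r L = ≤-trans (budget≤1+revs σ R r) (m≤n+m (suc r) (credit σ L))

trackDir-crossing-budget : ∀ σ d r → budget σ (d , r) < budget (not σ) (trackDir d r (toward (not σ)))
trackDir-crossing-budget true L r = n<1+n (suc r)
trackDir-crossing-budget true S r = n<1+n r
trackDir-crossing-budget true R r = n<1+n r
trackDir-crossing-budget false L r = n<1+n r
trackDir-crossing-budget false S r = n<1+n r
trackDir-crossing-budget false R r = n<1+n (suc r)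

module Reversals {k : ℕ} (M : Machine k) (m b : ℕ) where
  open Steps M
  open Boundary M m b
  open Runs M m b

  crossing-move : ∀ c → headSide (step M c) ≢ headSide c → streamMove (action c) ≡ toward (not (headSide c))
  crossing-move c moves with streamMove (action c) | step-thead c | headSide c in side-c
  ... | S | moved | _ = ⊥-elim (moves (trans (cong side moved) side-c))
  ... | L | moved | false = refl
  ... | L | moved | true = ⊥-elim (moves (trans (cong side moved)
                             (<⇒side≡true (≤-<-trans (move-L-≤ (Config.thead c)) (side≡true⇒< side-c)))))
  ... | R | moved | true = refl
  ... | R | moved | false = ⊥-elim (moves (trans (cong side moved)
                             (≥⇒side≡false (≤-trans (side≡false⇒≥ side-c) (n≤1+n (Config.thead c))))))

  dirRevs : Config M → Move × ℕ
  dirRevs c = Config.dir c , Config.revs c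

  crossings-length : ∀ {n} (s : Vec (Fin k) n) t →
                     length (crossings s t) ≤ budget (headSide (run M s t)) (dirRevs (run M s t))
  crossings-length s zero = z≤n
  crossings-length s (suc t) = by-cases (headSide (step M c) Bool.≟ headSide c)
    where
      open ≤-Reasoning
      c = run M s t
      by-cases : Dec (headSide (step M c) ≡ headSide c) →
                 length (crossings s (suc t)) ≤ budget (headSide (step M c)) (dirRevs (step M c))
      by-cases (yes stays) = begin
        length (crossings s (suc t))     ≡⟨ cong length (crossings-stay s t stays) ⟩
        length (crossings s t)           ≤⟨ crossings-length s t ⟩
        budget (headSide c) (dirRevs c)  ≤⟨ trackDir-budget (headSide c) _ _ (streamMove (action c)) ⟩
        budget (headSide c) (trackDir (Config.dir c) (Config.revs c) (streamMove (action c)))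
          ≡⟨ cong₂ budget (sym stays) (sym (step-dir-revs c)) ⟩
        budget (headSide (step M c)) (dirRevs (step M c)) ∎
      by-cases (no moves) = begin
        length (crossings s (suc t))     ≡⟨ cong length (crossings-cross s t moves) ⟩
        suc (length (crossings s t))     ≤⟨ s≤s (crossings-length s t) ⟩
        suc (budget (headSide c) (dirRevs c)) ≤⟨ trackDir-crossing-budget (headSide c) _ _ ⟩
        budget (not (headSide c)) (trackDir (Config.dir c) (Config.revs c) (toward (not (headSide c))))
          ≡⟨ cong₂ budget (sym (≢-not moves)) (sym (trans (step-dir-revs c) (cong (trackDir _ _) (crossing-move c moves)))) ⟩
        budget (headSide (step M c)) (dirRevs (step M c)) ∎

module Splicing {k : ℕ} (M : Machine k) (m b : ℕ) where
  open Steps M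
  open Boundary M m b
  open Runs M m b

  record Terminates {n : ℕ} (s : Vec (Fin k) n) : Set where
    field
      time   : ℕ
      halts  : Halted s time
      memory : ∀ t → MemoryWithin (run M s t)
  open Terminates

  module _ {nH : ℕ} (sH : Vec (Fin k) nH) where

    -- At time t the spliced run imitates the run on sX (at tx) on side σ, while the run on sY waits at ty.
    record Imitation (σ : Bool) {nX nY : ℕ} (sX : Vec (Fin k) nX) (sY : Vec (Fin k) nY) (t : ℕ) : Set where
      field
        tx ty  : ℕ
        hybrid : Hybrid σ (run M sH t) (run M sX tx) (run M sY ty)
        same   : crossings sX tx ≡ crossings sY ty

    module _ {nX nY : ℕ} {sX : Vec (Fin k) nX} {sY : Vec (Fin k) nY} (X : Terminates sX) (Y : Terminates sY)
             (same-final : crossings sX (time X) ≡ crossings sY (time Y)) where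

      Imitation-step : ∀ {σ t} → Imitation σ sX sY t → Imitation σ sX sY (suc t) ⊎ Imitation (not σ) sY sX (suc t)
      Imitation-step {σ} {t} I with headSide (run M sH (suc t)) Bool.≟ σ
      ... | yes stays = inj₁ record
        { tx = suc tx ; ty = ty ; hybrid = Hybrid-stay hybrid stays
        ; same = trans (crossings-stay sX tx (trans (trans (Hybrid-headSide-step hybrid) stays) (sym (Hybrid.x-side hybrid)))) same }
        where open Imitation I
      ... | no stays = inj₂ record
        { tx = suc at ; ty = suc tx
        ; hybrid = Hybrid-switch hybrid h-crosses (run M sY (suc at)) arrives entry≡
                     (memory Y (suc at)) (memory X (suc tx))
                     (trans (crossing-thead σ (run M sY at) leaves arrives)
                            (sym (crossing-thead σ (run M sX tx) (Hybrid.x-side hybrid) x-crosses)))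
                     tape-kept
        ; same = trans crossings≡ (sym (trans x-crossings (cong (_ ∷_) same))) }
        where
          open Imitation I
          h-crosses : headSide (run M sH (suc t)) ≡ not σ
          h-crosses = ≢-not stays
          x-crosses : headSide (run M sX (suc tx)) ≡ not σ
          x-crosses = trans (Hybrid-headSide-step hybrid) h-crosses
          x-moves : headSide (run M sX (suc tx)) ≢ headSide (run M sX tx)
          x-moves eq = not-≢ (trans (sym x-crosses) (trans eq (Hybrid.x-side hybrid)))
          x-crossings : crossings sX (suc tx) ≡ entry (run M sX (suc tx)) ∷ crossings sX tx
          x-crossings = crossings-cross sX tx x-moves
          x-later : ∃ λ d → suc tx + d ≡ time X
          x-later = m≤n⇒∃[o]m+o≡n (moves⇒<halt sX (halts X) x-moves)
          x-rest : ∃ λ Z → crossings sX (suc tx + proj₁ x-later) ≡ Z List.++ crossings sX (suc tx)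
          x-rest = crossings-extend sX (suc tx) (proj₁ x-later)
          -- The run on sY must still make the crossing just made by sX.
          y-final : crossings sY (time Y) ≡ proj₁ x-rest List.++ entry (run M sX (suc tx)) ∷ crossings sY ty
          y-final = trans (sym same-final) (trans (cong (crossings sX) (sym (proj₂ x-later)))
            (trans (proj₂ x-rest) (cong (proj₁ x-rest List.++_) (trans x-crossings (cong (_ ∷_) same)))))
          y-later : ∃ λ d → ty + d ≡ time Y
          y-later = m≤n⇒∃[o]m+o≡n (grows⇒≤halt sY (halts Y) y-final)
          c : CrossingAfter sY σ ty (entry (run M sX (suc tx))) (crossings sY ty)
          c = next-crossing sY σ (proj₁ y-later) ty (Hybrid.y-side hybrid) refl
                (trans (cong (crossings sY) (proj₂ y-later)) y-final)
          open CrossingAfter sY c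

    halted-output : ∀ {n} {s : Vec (Fin k) n} (run-s : Terminates s) {T σ x y} → Halted sH T →
                    Hybrid σ (run M sH T) (run M s x) y → Config.mem (run M sH T) ≗ Config.mem (run M s (time run-s))
    halted-output {s = s} run-s {x = x} halted H i = trans (same-mem (Hybrid.agree H) i) (cong (λ c → Config.mem c i)
      (Halted-unique s {x} {time run-s} (trans (cong (Machine.halt M) (sym (same-state (Hybrid.agree H)))) halted) (halts run-s)))

    module _ {nA nB : ℕ} {sA : Vec (Fin k) nA} {sB : Vec (Fin k) nB} (A : Terminates sA) (B : Terminates sB)
             (same-final : crossings sA (time A) ≡ crossings sB (time B)) (0<m : 0 < m)
             (left  : ∀ j → side j ≡ true  → Config.tape (run M sH 0) j ≡ Config.tape (run M sA 0) j)
             (right : ∀ j → side j ≡ false → Config.tape (run M sH 0) j ≡ Config.tape (run M sB 0) j) where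

      imitation : ∀ t → Imitation true sA sB t ⊎ Imitation false sB sA t
      imitation zero = inj₁ record
        { tx = 0 ; ty = 0 ; same = refl
        ; hybrid = record
          { h-side = <⇒side≡true 0<m ; x-side = <⇒side≡true 0<m ; y-side = <⇒side≡true 0<m
          ; agree = record { same-state = refl ; same-mem = λ _ → refl ; same-mhead = refl ; same-thead = refl }
          ; tape-x = left ; tape-y = right } }
      imitation (suc t) with imitation t
      ... | inj₁ I = Imitation-step A B same-final I
      ... | inj₂ I = swap (Imitation-step B A (sym same-final) I)

      spliced-output : ∀ {T} → Halted sH T →
        Config.mem (run M sH T) ≗ Config.mem (run M sA (time A)) ⊎ Config.mem (run M sH T) ≗ Config.mem (run M sB (time B))
      spliced-output {T} halted with imitation T
      ... | inj₁ I = inj₁ (halted-output A {T} {x = Imitation.tx I} halted (Imitation.hybrid I))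
      ... | inj₂ I = inj₂ (halted-output B {T} {x = Imitation.tx I} halted (Imitation.hybrid I))

-- The fooling set

module FoolingPairs {k : ℕ} (M : Machine k) (N b : ℕ) where
  open Machine M using (Q)
  open Boundary M N b
  open Runs M N b
  open Reversals M N b
  open Splicing M N b

  terminates : ∀ {n} {s : Vec (Fin k) n} → FindsMinPeriodWithin M b s → Terminates s
  terminates {s = s} (T , halts , mhead<b , _) =
    record { time = T ; halts = halts ; memory = run-MemoryWithin s mhead<b }

  crossingCode : ∀ {n} {s : Vec (Fin k) n} → FindsMinPeriodWithin M b s → Fin (suc (Q * (2 ^ b * b)) ^ b)
  crossingCode {s = s} (T , _ , mhead<b , passes , _) =
    listCode tripleCode tripleCode-injective b (crossings s T) (crossings-heads s mhead<b T)
      (≤-trans (crossings-length s T) (≤-trans (budget≤1+revs _ _ _) passes))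

  crossingCode-injective : ∀ {n n′} {s : Vec (Fin k) n} {s′ : Vec (Fin k) n′}
                           (F : FindsMinPeriodWithin M b s) (F′ : FindsMinPeriodWithin M b s′) →
                           crossingCode F ≡ crossingCode F′ → crossings s (proj₁ F) ≡ crossings s′ (proj₁ F′)
  crossingCode-injective F F′ = listCode-injective tripleCode tripleCode-injective b _ _ _ _ _ _

  -- Equal crossing sequences at the middle of u u and v v let u v imitate one of them, so u v has period N.
  fooling-pair : ∀ (u v : Vec (Fin k) N) → 0 < N →
                 (Fu : FindsMinPeriodWithin M b (u ++ u)) (Fv : FindsMinPeriodWithin M b (v ++ v)) →
                 FindsMinPeriodWithin M b (u ++ v) →
                 IsMinPeriod (u ++ u) N → IsMinPeriod (v ++ v) N → crossingCode Fu ≡ crossingCode Fv → u ≡ v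
  fooling-pair u v 0<N Fu@(_ , _ , _ , _ , uu-output) Fv@(_ , _ , _ , _ , vv-output) (T , halts , _ , _ , uv-output)
               uu-N vv-N same-code =
    ++-period⇒≡ u v (proj₁ (proj₂ (subst (IsMinPeriod (u ++ v)) output≡N uv-output)))
    where
      left : ∀ j → side j ≡ true → Config.tape (run M (u ++ v) 0) j ≡ Config.tape (run M (u ++ u) 0) j
      left j sj = trans (initTape-++ˡ u v (side≡true⇒< sj)) (sym (initTape-++ˡ u u (side≡true⇒< sj)))
      right : ∀ j → side j ≡ false → Config.tape (run M (u ++ v) 0) j ≡ Config.tape (run M (v ++ v) 0) j
      right j sj = subst (λ i → Config.tape (run M (u ++ v) 0) i ≡ Config.tape (run M (v ++ v) 0) i)
        (m+[n∸m]≡n (side≡false⇒≥ sj)) (trans (initTape-++ʳ u v (j ∸ N)) (sym (initTape-++ʳ v v (j ∸ N))))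
      output≡N : binVal (Config.mem (run M (u ++ v) T)) b ≡ N
      output≡N with spliced-output (u ++ v) (terminates Fu) (terminates Fv)
                      (crossingCode-injective Fu Fv same-code) 0<N left right {T} halts
      ... | inj₁ same-mem = trans (binVal-cong same-mem b) (minPeriod-unique (u ++ u) uu-output uu-N)
      ... | inj₂ same-mem = trans (binVal-cong same-mem b) (minPeriod-unique (v ++ v) vv-output vv-N)

corollary2 : (k : ℕ) → 2 ≤ k →
    ¬ (Σ (Machine k) λ M → Σ ℕ λ c →
         (n : ℕ) (s : Vec (Fin k) n) → FindsMinPeriodWithin M (polylog c n) s)
corollary2 (suc (suc k′)) (s≤s (s≤s z≤n)) (M , c , finds) = no-collision (pigeonhole codes<inputs′ code)
  where
    Q : ℕ
    Q = Machine.Q M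
    j : ℕ
    j = proj₁ (codes<inputs Q c)
    K : ℕ
    K = 2 ^ j ∸ 1
    open Blocks k′ K
    n : ℕ
    n = blockLength + blockLength
    b : ℕ
    b = polylog c n
    open FoolingPairs M blockLength b

    b≡ : b ≡ c * (3 + j) ^ c
    b≡ = trans (cong (polylog c) (doubleBlockLength j)) (polylog[2^n] c (2 + j))

    codes<inputs′ : suc (Q * (2 ^ b * b)) ^ b < 2 ^ K
    codes<inputs′ = subst (λ B → suc (Q * (2 ^ B * B)) ^ B < 2 ^ K) (sym b≡) (proj₂ (codes<inputs Q c))

    fooling : Fin (2 ^ K) → Vec (Fin (suc (suc k′))) n
    fooling i = block (finToFun i) ++ block (finToFun i)

    code : Fin (2 ^ K) → Fin (suc (Q * (2 ^ b * b)) ^ b)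
    code i = crossingCode (finds n (fooling i))

    no-collision : ¬ ∃₂ (λ i i′ → i Fin.< i′ × code i ≡ code i′)
    no-collision (i , i′ , i<i′ , same-code) = Finₚ.<⇒≢ i<i′ (finToFun-injective i i′ (block-injective _ _
      (fooling-pair (block (finToFun i)) (block (finToFun i′)) (s≤s z≤n)
                    (finds n (fooling i)) (finds n (fooling i′)) (finds n _)
                    (block-minPeriod _) (block-minPeriod _) same-code)))
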